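{- Let $n>1$ be an integer and let $a,b\in GP(\mathbb Z_n)$ be such that $a-1,b-1\in GP(\mathbb Z_n)$. Then the meet $a\wedge b$ exists in the poset $(\mathbb Z_n,\leq)$, and $a\wedge b\in GP(\mathbb Z_n)$.
   Context: On $\mathbb Z_n$ define the partial order $\leq$ by: $a\leq b$ iff $a=b$ or $a\equiv ab\pmod n$. $GP(\mathbb Z_n)$ is the set of $a\in\mathbb Z_n$ with $a^m=a$ for some integer $m\geq2$. -}

module Defs where

open import Data.Nat using (ℕ; zero; suc; _+_; _*_; _∸_; _≤_; NonZero)
open import Data.Nat.DivMod using (_%_; m%n<n)
open import Data.Fin using (Fin; toℕ; fromℕ<)
open import Data.Product using (Σ; _×_; ∃-syntax)
open import Data.Sum using (_⊎_)
open import Relation.Binary.PropositionalEquality using (_≡_)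

ℤ/ : ℕ → Set
ℤ/ n = Fin n

reduce : ∀ {n} .{{_ : NonZero n}} → ℕ → ℤ/ n
reduce {n} k = fromℕ< (m%n<n k n)

_·_ : ∀ {n} .{{_ : NonZero n}} → ℤ/ n → ℤ/ n → ℤ/ n
a · b = reduce (toℕ a * toℕ b)


one : ∀ {n} .{{_ : NonZero n}} → ℤ/ n
one = reduce 1

minus1 : ∀ {n} .{{_ : NonZero n}} → ℤ/ n → ℤ/ n
minus1 {n} a = reduce (toℕ a + (n ∸ 1))

_^_ : ∀ {n} .{{_ : NonZero n}} → ℤ/ n → ℕ → ℤ/ n
a ^ zero = one
a ^ suc m = a · (a ^ m)

_≼_ : ∀ {n} .{{_ : NonZero n}} → ℤ/ n → ℤ/ n → Set
a ≼ b = a ≡ b ⊎ a ≡ a · b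

GP : ∀ {n} .{{_ : NonZero n}} → ℤ/ n → Set
GP a = ∃[ m ] (2 ≤ m × a ^ m ≡ a)

IsMeet : ∀ {n} .{{_ : NonZero n}} → ℤ/ n → ℤ/ n → ℤ/ n → Set
IsMeet a b c = c ≼ a × c ≼ b × (∀ d → d ≼ a → d ≼ b → d ≼ c)

-- If (a - 1)^(k+2) = a - 1 in a commutative ring, then e = 1 - (a - 1)^(k+1) is the
-- largest element d with d a = d (d a = d means exactly that d kills a - 1). So for
-- two such elements a, b the idempotent e_a e_b is the largest d with d a = d = d b.
-- In (ℤ_n, ≤) the lower bounds of a and b are these d together with a or b itself
-- when a ≤ b or b ≤ a, so the meet is a, b or e_a e_b, each of which lies in GP.
module Submission where

open import Algebra.Bundles using (CommutativeRing)
open import Data.Fin using (toℕ; _≟_)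
open import Data.Fin.Properties using (toℕ-fromℕ<; toℕ-injective; toℕ<n)
open import Data.Nat as ℕ using (ℕ; suc; _∸_; _<_; NonZero; s≤s; z≤n)
open import Data.Nat.DivMod using (_%_; m%n<n; m%n%n≡m%n; m<n⇒m%n≡m; m*n%n≡0; %-distribˡ-+; %-distribˡ-*)
import Data.Nat.Properties as ℕ
open import Data.Product using (_×_; _,_; ∃-syntax)
open import Data.Sum using (_⊎_; inj₁; inj₂)
open import Level using (_⊔_; 0ℓ)
open import Relation.Binary.PropositionalEquality as ≡ using (_≡_; refl; cong; cong₂)
import Relation.Binary.Construct.On as On
open import Relation.Nullary using (Dec; yes; no; contradiction)
open import Relation.Nullary.Decidable using (_⊎-dec_)

module GreatestBelow {c ℓ} (R : CommutativeRing c ℓ) where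

  open CommutativeRing R
  open import Algebra.Properties.Ring ring using (x[y-z]≈xy-xz; [y-z]x≈yx-zx; -0#≈0#; x∙y⁻¹≈ε⇒x≈y)
  open import Algebra.Properties.Semiring.Exp semiring using (_^_)
  open import Relation.Binary.Reasoning.Setoid setoid

  infix 4 _⊑_
  _⊑_ : Carrier → Carrier → Set ℓ
  d ⊑ a = d * a ≈ d

  ⊑-respˡ : ∀ {d d′ a} → d ≈ d′ → d ⊑ a → d′ ⊑ a
  ⊑-respˡ {d} {d′} {a} d≈d′ d⊑a = begin
    d′ * a ≈⟨ *-congʳ d≈d′ ⟨
    d * a  ≈⟨ d⊑a ⟩
    d      ≈⟨ d≈d′ ⟩
    d′     ∎

  ⊑-respʳ : ∀ {d a a′} → a ≈ a′ → d ⊑ a → d ⊑ a′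
  ⊑-respʳ a≈a′ d⊑a = trans (*-congˡ (sym a≈a′)) d⊑a

  ⊑⇒*[x-1]≈0 : ∀ {d a} → d ⊑ a → d * (a - 1#) ≈ 0#
  ⊑⇒*[x-1]≈0 {d} {a} d⊑a = begin
    d * (a - 1#)    ≈⟨ x[y-z]≈xy-xz d a 1# ⟩
    d * a - d * 1#  ≈⟨ +-cong d⊑a (-‿cong (*-identityʳ d)) ⟩
    d - d           ≈⟨ -‿inverseʳ d ⟩
    0#              ∎

  *[x-1]≈0⇒⊑ : ∀ {d a} → d * (a - 1#) ≈ 0# → d ⊑ a
  *[x-1]≈0⇒⊑ {d} {a} d[a-1]≈0 = x∙y⁻¹≈ε⇒x≈y (d * a) d (begin
    d * a - d       ≈⟨ +-congˡ (-‿cong (*-identityʳ d)) ⟨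
    d * a - d * 1#  ≈⟨ x[y-z]≈xy-xz d a 1# ⟨
    d * (a - 1#)    ≈⟨ d[a-1]≈0 ⟩
    0#              ∎)

  IsGreatestBelow : Carrier → Carrier → Set (c ⊔ ℓ)
  IsGreatestBelow a e = e ⊑ a × (∀ d → d ⊑ a → d ⊑ e)

  IsGreatestCommonBelow : Carrier → Carrier → Carrier → Set (c ⊔ ℓ)
  IsGreatestCommonBelow a b e = e ⊑ a × e ⊑ b × (∀ d → d ⊑ a → d ⊑ b → d ⊑ e)

  -- With t = a - 1 and g = t ^ (1 + k) we have g t = t, so 1 - g kills t and is
  -- therefore below a; any d below a kills t, hence g, hence lies below 1 - g.
  1-[x-1]^[1+k]-isGreatestBelow : ∀ a k → (a - 1#) ^ (2 ℕ.+ k) ≈ a - 1# →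
                                 IsGreatestBelow a (1# - (a - 1#) ^ suc k)
  1-[x-1]^[1+k]-isGreatestBelow a k t^[2+k]≈t = e⊑a , ⊑a⇒⊑e
    where
    t g : Carrier
    t = a - 1#
    g = t ^ suc k

    e⊑a : 1# - g ⊑ a
    e⊑a = *[x-1]≈0⇒⊑ (begin
      (1# - g) * t    ≈⟨ [y-z]x≈yx-zx t 1# g ⟩
      1# * t - g * t  ≈⟨ +-cong (*-identityˡ t) (-‿cong (trans (*-comm g t) t^[2+k]≈t)) ⟩
      t - t           ≈⟨ -‿inverseʳ t ⟩
      0#              ∎)

    ⊑a⇒⊑e : ∀ d → d ⊑ a → d ⊑ 1# - g
    ⊑a⇒⊑e d d⊑a = begin
      d * (1# - g)    ≈⟨ x[y-z]≈xy-xz d 1# g ⟩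
      d * 1# - d * g  ≈⟨ +-cong (*-identityʳ d) (-‿cong dg≈0) ⟩
      d - 0#          ≈⟨ +-congˡ -0#≈0# ⟩
      d + 0#          ≈⟨ +-identityʳ d ⟩
      d               ∎
      where
      dg≈0 : d * g ≈ 0#
      dg≈0 = begin
        d * (t * t ^ k)  ≈⟨ *-assoc d t (t ^ k) ⟨
        d * t * t ^ k    ≈⟨ *-congʳ (⊑⇒*[x-1]≈0 d⊑a) ⟩
        0# * t ^ k       ≈⟨ zeroˡ (t ^ k) ⟩
        0#               ∎

  *-isGreatestCommonBelow : ∀ {a b e f} → IsGreatestBelow a e → IsGreatestBelow b f →
                            IsGreatestCommonBelow a b (e * f)
  *-isGreatestCommonBelow {a} {b} {e} {f} (e⊑a , ⊑a⇒⊑e) (f⊑b , ⊑b⇒⊑f) = ef⊑a , ef⊑b , ⊑ef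
    where
    ef⊑a : e * f ⊑ a
    ef⊑a = begin
      e * f * a    ≈⟨ *-congʳ (*-comm e f) ⟩
      f * e * a    ≈⟨ *-assoc f e a ⟩
      f * (e * a)  ≈⟨ *-congˡ e⊑a ⟩
      f * e        ≈⟨ *-comm f e ⟩
      e * f        ∎

    ef⊑b : e * f ⊑ b
    ef⊑b = trans (*-assoc e f b) (*-congˡ f⊑b)

    ⊑ef : ∀ d → d ⊑ a → d ⊑ b → d ⊑ e * f
    ⊑ef d d⊑a d⊑b = begin
      d * (e * f)  ≈⟨ *-assoc d e f ⟨
      d * e * f    ≈⟨ *-congʳ (⊑a⇒⊑e d d⊑a) ⟩
      d * f        ≈⟨ ⊑b⇒⊑f d d⊑b ⟩
      d            ∎

  isGreatestCommonBelow-resp : ∀ {a b e e′} → e ≈ e′ →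
                               IsGreatestCommonBelow a b e → IsGreatestCommonBelow a b e′
  isGreatestCommonBelow-resp e≈e′ (e⊑a , e⊑b , ⊑e) =
    ⊑-respˡ e≈e′ e⊑a , ⊑-respˡ e≈e′ e⊑b , λ d d⊑a d⊑b → ⊑-respʳ e≈e′ (⊑e d d⊑a d⊑b)

  isGreatestCommonBelow⇒idempotent : ∀ {a b e} → IsGreatestCommonBelow a b e → e ⊑ e
  isGreatestCommonBelow⇒idempotent (e⊑a , e⊑b , ⊑e) = ⊑e _ e⊑a e⊑b

module ℕModulo (n : ℕ) .{{_ : NonZero n}} where

  open ≡.≡-Reasoning

  infix 4 _≈_
  _≈_ : ℕ → ℕ → Set
  x ≈ y = x % n ≡ y % n

  ≡⇒≈ : ∀ {x y} → x ≡ y → x ≈ y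
  ≡⇒≈ = cong (_% n)

  -_ : ℕ → ℕ
  - x = (n ∸ 1) ℕ.* x

  +-cong : ∀ {x x′ y y′} → x ≈ x′ → y ≈ y′ → x ℕ.+ y ≈ x′ ℕ.+ y′
  +-cong {x} {x′} {y} {y′} x≈x′ y≈y′ = begin
    (x ℕ.+ y) % n              ≡⟨ %-distribˡ-+ x y n ⟩
    (x % n ℕ.+ y % n) % n      ≡⟨ cong₂ (λ u v → (u ℕ.+ v) % n) x≈x′ y≈y′ ⟩
    (x′ % n ℕ.+ y′ % n) % n    ≡⟨ %-distribˡ-+ x′ y′ n ⟨
    (x′ ℕ.+ y′) % n            ∎

  *-cong : ∀ {x x′ y y′} → x ≈ x′ → y ≈ y′ → x ℕ.* y ≈ x′ ℕ.* y′
  *-cong {x} {x′} {y} {y′} x≈x′ y≈y′ = begin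
    (x ℕ.* y) % n                ≡⟨ %-distribˡ-* x y n ⟩
    ((x % n) ℕ.* (y % n)) % n    ≡⟨ cong₂ (λ u v → (u ℕ.* v) % n) x≈x′ y≈y′ ⟩
    ((x′ % n) ℕ.* (y′ % n)) % n  ≡⟨ %-distribˡ-* x′ y′ n ⟨
    (x′ ℕ.* y′) % n              ∎

  -‿inverseˡ : ∀ x → - x ℕ.+ x ≈ 0
  -‿inverseˡ x = begin
    ((n ∸ 1) ℕ.* x ℕ.+ x) % n  ≡⟨ ≡⇒≈ (ℕ.+-comm ((n ∸ 1) ℕ.* x) x) ⟩
    (suc (n ∸ 1) ℕ.* x) % n    ≡⟨ ≡⇒≈ (cong (ℕ._* x) suc[n∸1]≡n) ⟩
    (n ℕ.* x) % n              ≡⟨ ≡⇒≈ (ℕ.*-comm n x) ⟩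
    (x ℕ.* n) % n              ≡⟨ m*n%n≡0 x n ⟩
    0                          ≡⟨ m*n%n≡0 0 n ⟨
    0 % n                      ∎
    where
    suc[n∸1]≡n : suc (n ∸ 1) ≡ n
    suc[n∸1]≡n = ≡.trans (cong suc (≡.sym (ℕ.pred[m∸n]≡m∸[1+n] n 0))) (ℕ.suc-pred n)

  commutativeRing : CommutativeRing 0ℓ 0ℓ
  commutativeRing = record
    { Carrier = ℕ
    ; _≈_ = _≈_
    ; _+_ = ℕ._+_
    ; _*_ = ℕ._*_
    ; -_ = -_
    ; 0# = 0
    ; 1# = 1
    ; isCommutativeRing = record
      { isRing = record
        { +-isAbelianGroup = record
          { isGroup = record
            { isMonoid = record
              { isSemigroup = record
                { isMagma = record
                  { isEquivalence = On.isEquivalence (_% n) ≡.isEquivalence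
                  ; ∙-cong = +-cong
                  }
                ; assoc = λ x y z → ≡⇒≈ (ℕ.+-assoc x y z)
                }
              ; identity = (λ x → refl) , (λ x → ≡⇒≈ (ℕ.+-identityʳ x))
              }
            ; inverse = -‿inverseˡ , (λ x → ≡.trans (≡⇒≈ (ℕ.+-comm x (- x))) (-‿inverseˡ x))
            ; ⁻¹-cong = *-cong {n ∸ 1} refl
            }
          ; comm = λ x y → ≡⇒≈ (ℕ.+-comm x y)
          }
        ; *-cong = *-cong
        ; *-assoc = λ x y z → ≡⇒≈ (ℕ.*-assoc x y z)
        ; *-identity = (λ x → ≡⇒≈ (ℕ.*-identityˡ x)) , (λ x → ≡⇒≈ (ℕ.*-identityʳ x))
        ; distrib = (λ x y z → ≡⇒≈ (ℕ.*-distribˡ-+ x y z)) , (λ x y z → ≡⇒≈ (ℕ.*-distribʳ-+ x y z))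
        }
      ; *-comm = λ x y → ≡⇒≈ (ℕ.*-comm x y)
      }
    }

open import Defs

module Residues (n : ℕ) .{{_ : NonZero n}} where

  open ℕModulo n using (commutativeRing; ≡⇒≈)
  open CommutativeRing commutativeRing using (_≈_; _*_; _-_; 1#; sym; trans; *-congˡ; *-identityʳ; semiring)
  open import Algebra.Properties.Semiring.Exp semiring using (^-congˡ) renaming (_^_ to _^ᴿ_)
  open import Relation.Binary.Reasoning.Setoid (CommutativeRing.setoid commutativeRing)
  open GreatestBelow commutativeRing public

  toℕ-reduce : ∀ k → toℕ (reduce {n} k) ≈ k
  toℕ-reduce k = ≡.trans (cong (_% n) (toℕ-fromℕ< (m%n<n k n))) (m%n%n≡m%n k n)

  toℕ-· : ∀ (x y : ℤ/ n) → toℕ (x · y) ≈ toℕ x * toℕ y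
  toℕ-· x y = toℕ-reduce (toℕ x * toℕ y)

  toℕ-^ : ∀ (x : ℤ/ n) m → toℕ (x ^ m) ≈ toℕ x ^ᴿ m
  toℕ-^ x ℕ.zero    = toℕ-reduce 1
  toℕ-^ x (suc m) = trans (toℕ-· x (x ^ m)) (*-congˡ {toℕ x} (toℕ-^ x m))

  toℕ-minus1 : ∀ (x : ℤ/ n) → toℕ (minus1 x) ≈ toℕ x - 1#
  toℕ-minus1 x = trans (toℕ-reduce _) (≡⇒≈ (cong (toℕ x ℕ.+_) (≡.sym (ℕ.*-identityʳ (n ∸ 1)))))

  toℕ-cong : ∀ {x y : ℤ/ n} → x ≡ y → toℕ x ≈ toℕ y
  toℕ-cong x≡y = ≡⇒≈ (cong toℕ x≡y)

  toℕ-injective-≈ : ∀ {x y : ℤ/ n} → toℕ x ≈ toℕ y → x ≡ y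
  toℕ-injective-≈ {x} {y} x≈y = toℕ-injective
    (≡.trans (≡.sym (m<n⇒m%n≡m (toℕ<n x))) (≡.trans x≈y (m<n⇒m%n≡m (toℕ<n y))))

  ⊑⇒≡· : ∀ {x y : ℤ/ n} → toℕ x ⊑ toℕ y → x ≡ x · y
  ⊑⇒≡· {x} {y} x⊑y = toℕ-injective-≈ (sym (trans (toℕ-· x y) x⊑y))

  ≡·⇒⊑ : ∀ {x y : ℤ/ n} → x ≡ x · y → toℕ x ⊑ toℕ y
  ≡·⇒⊑ {x} {y} x≡xy = trans (sym (toℕ-· x y)) (sym (toℕ-cong x≡xy))

  GP-minus1⇒greatestBelow : ∀ {a : ℤ/ n} → GP (minus1 a) → ∃[ e ] IsGreatestBelow (toℕ a) e
  GP-minus1⇒greatestBelow (1 , s≤s () , _)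
  GP-minus1⇒greatestBelow {a} (suc (suc k) , _ , [a-1]^m≡a-1) =
    1# - (toℕ a - 1#) ^ᴿ suc k , 1-[x-1]^[1+k]-isGreatestBelow (toℕ a) k (begin
      (toℕ a - 1#) ^ᴿ m       ≈⟨ ^-congˡ m (toℕ-minus1 a) ⟨
      toℕ (minus1 a) ^ᴿ m     ≈⟨ toℕ-^ (minus1 a) m ⟨
      toℕ (minus1 a ^ m)      ≈⟨ toℕ-cong [a-1]^m≡a-1 ⟩
      toℕ (minus1 a)          ≈⟨ toℕ-minus1 a ⟩
      toℕ a - 1#              ∎)
    where
    m : ℕ
    m = suc (suc k)

  GP-minus1⇒greatestCommonBelow : ∀ {a b : ℤ/ n} → GP (minus1 a) → GP (minus1 b) →
                                   ∃[ c ] IsGreatestCommonBelow (toℕ a) (toℕ b) (toℕ c)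
  GP-minus1⇒greatestCommonBelow gp[a-1] gp[b-1]
    with e , e-greatest ← GP-minus1⇒greatestBelow gp[a-1]
       | f , f-greatest ← GP-minus1⇒greatestBelow gp[b-1]
    = reduce (e * f)
    , isGreatestCommonBelow-resp (sym (toℕ-reduce (e * f))) (*-isGreatestCommonBelow e-greatest f-greatest)

  ⊑-refl⇒GP : ∀ {c : ℤ/ n} → toℕ c ⊑ toℕ c → GP c
  ⊑-refl⇒GP {c} c⊑c = 2 , s≤s (s≤s z≤n) , toℕ-injective-≈ (begin
    toℕ (c ^ 2)             ≈⟨ toℕ-^ c 2 ⟩
    toℕ c * (toℕ c * 1#)    ≈⟨ *-congˡ {toℕ c} (*-identityʳ (toℕ c)) ⟩
    toℕ c * toℕ c           ≈⟨ c⊑c ⟩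
    toℕ c                   ∎)

  infix 4 _≼?_
  _≼?_ : ∀ (x y : ℤ/ n) → Dec (x ≼ y)
  x ≼? y = (x ≟ y) ⊎-dec (x ≟ x · y)

  -- a ≼ a holds through the clause a = b only (a · a ≠ a in general), so a lower bound
  -- equal to a or b need not be ⊑-below c; then a or b itself is the meet.
  greatestCommonBelow⇒meet : ∀ {a b c : ℤ/ n} → IsGreatestCommonBelow (toℕ a) (toℕ b) (toℕ c) →
                             IsMeet a b a ⊎ IsMeet a b b ⊎ IsMeet a b c
  greatestCommonBelow⇒meet {a} {b} {c} (c⊑a , c⊑b , ⊑c) with a ≼? b | b ≼? a
  ... | yes a≼b | _       = inj₁ (inj₁ refl , a≼b , λ _ d≼a _ → d≼a)
  ... | no _    | yes b≼a = inj₂ (inj₁ (b≼a , inj₁ refl , λ _ _ d≼b → d≼b))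
  ... | no a⋠b  | no b⋠a  = inj₂ (inj₂ (inj₂ (⊑⇒≡· c⊑a) , inj₂ (⊑⇒≡· c⊑b) , lower))
    where
    lower : ∀ d → d ≼ a → d ≼ b → d ≼ c
    lower d (inj₁ refl)  d≼b         = contradiction d≼b a⋠b
    lower d (inj₂ d≡da) (inj₁ refl)  = contradiction (inj₂ d≡da) b⋠a
    lower d (inj₂ d≡da) (inj₂ d≡db) = inj₂ (⊑⇒≡· (⊑c (toℕ d) (≡·⇒⊑ d≡da) (≡·⇒⊑ d≡db)))

theorem3p10 : (n : ℕ) .{{_ : NonZero n}} → 1 < n → (a b : ℤ/ n) →
              GP a → GP b → GP (minus1 a) → GP (minus1 b) →
              ∃[ c ] (IsMeet a b c × GP c)
theorem3p10 n _ a b gp-a gp-b gp[a-1] gp[b-1] = meetWithGP (GP-minus1⇒greatestCommonBelow gp[a-1] gp[b-1])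
  where
  open Residues n

  meetWithGP : ∃[ c ] IsGreatestCommonBelow (toℕ a) (toℕ b) (toℕ c) → ∃[ c ] (IsMeet a b c × GP c)
  meetWithGP (c , c-greatest) with greatestCommonBelow⇒meet c-greatest
  ... | inj₁ a-meet        = a , a-meet , gp-a
  ... | inj₂ (inj₁ b-meet) = b , b-meet , gp-b
  ... | inj₂ (inj₂ c-meet) = c , c-meet , ⊑-refl⇒GP (isGreatestCommonBelow⇒idempotent c-greatest)
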